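{- For any graph $G$, $tb(G)\le 1$ if and only if $G$ admits a star-decomposition.
   Context: Graphs are finite, simple, connected and unweighted. A tree decomposition $(T,\mathcal{X})$ of $G=(V,E)$ is a tree $T$ with bags $X_t\subseteq V$ such that every vertex lies in a bag, every edge has both ends in a common bag, and for each vertex the bags containing it induce a subtree. The radius of a bag $X_t$ is $\min_{v\in V}\max_{w\in X_t}dist_G(v,w)$; the breadth of a decomposition is its maximum bag radius; $tb(G)$ is the minimum breadth of a tree decomposition of $G$. A star-decomposition is a tree decomposition in which every bag $X_t$ contains a vertex adjacent to all other vertices of $X_t$ (i.e. $\gamma(G[X_t])=1$). -}

module Defs where

open import Data.Nat using (ℕ; zero; suc; _≤_)
open import Data.Fin using (Fin)
open import Data.Fin.Subset using (Subset; _∈_)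
open import Data.List using (List; []; _∷_)
open import Data.List.Relation.Unary.Unique.Propositional using (Unique)
open import Data.Product using (Σ; ∃; _×_)
open import Data.Empty using (⊥)
open import Relation.Nullary using (¬_; Dec)
open import Relation.Binary.PropositionalEquality using (_≡_)

record Graph (n : ℕ) : Set₁ where
  field
    Adj     : Fin n → Fin n → Set
    adj?    : ∀ u v → Dec (Adj u v)
    sym     : ∀ {u v} → Adj u v → Adj v u
    irrefl  : ∀ {u} → ¬ Adj u u
open Graph public

data Walk {V : Set} (E : V → V → Set) : V → V → ℕ → Set where
  [] : ∀ {u} → Walk E u u zero
  _∷_ : ∀ {u v w k} → E u v → Walk E v w k → Walk E u w (suc k)

walkVertices : ∀ {V : Set} {E : V → V → Set} {u w k} → Walk E u w k → List V
walkVertices {u = u} [] = u ∷ []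
walkVertices {u = u} (_ ∷ p) = u ∷ walkVertices p

module _ {n : ℕ} (G : Graph n) where

  Connected : Set
  Connected = ∀ u v → ∃ λ k → Walk (Adj G) u v k

  DistLe : Fin n → Fin n → ℕ → Set
  DistLe u v r = ∃ λ k → k ≤ r × Walk (Adj G) u v k

  Acyclic : Set
  Acyclic = ∀ {u v k} (p : Walk (Adj G) u v k) →
            2 ≤ k → Unique (walkVertices p) → Adj G v u → ⊥

  IsTree : Set
  IsTree = Connected × Acyclic

  InducesConnected : (Fin n → Set) → Set
  InducesConnected S =
    ∀ t t' → S t → S t' →
    ∃ λ k → Walk (λ a b → Adj G a b × S a × S b) t t' k

record TreeDecomposition {n : ℕ} (G : Graph n) : Set₁ where
  field
    m       : ℕ
    T       : Graph m
    isTree  : IsTree T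
    bag     : Fin m → Subset n
    covers  : ∀ (v : Fin n) → ∃ λ t → v ∈ bag t
    edgeIn  : ∀ u v → Adj G u v → ∃ λ t → u ∈ bag t × v ∈ bag t
    subtree : ∀ (v : Fin n) → InducesConnected T (λ t → v ∈ bag t)
open TreeDecomposition public

module _ {n : ℕ} {G : Graph n} (D : TreeDecomposition G) where

  BagRadiusLe : Fin (m D) → ℕ → Set
  BagRadiusLe t r = ∃ λ v → ∀ w → w ∈ bag D t → DistLe G v w r

  BreadthLe : ℕ → Set
  BreadthLe r = ∀ t → BagRadiusLe t r

  IsStarDecomposition : Set
  IsStarDecomposition =
    ∀ t → ∃ λ c → c ∈ bag D t × (∀ w → w ∈ bag D t → ¬ (w ≡ c) → Adj G c w)

TreeBreadthLe : ∀ {n} → Graph n → ℕ → Set₁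
TreeBreadthLe G r = Σ (TreeDecomposition G) λ D → BreadthLe D r

HasStarDecomposition : ∀ {n} → Graph n → Set₁
HasStarDecomposition G = Σ (TreeDecomposition G) IsStarDecomposition

-- A star-decomposition has breadth at most 1, its star centres being centres of the bags.
-- Conversely, start from a decomposition of breadth 1 in which some bag X_t misses its
-- centre c. Every w ∈ X_t is adjacent to c, so X_t shares a bag with c element by element.
-- Walking in the tree from t towards the subtree of c, the bags cannot lose any element
-- of X_t (that would close a cycle in the tree), so some tree edge xy has X_x ⊊ X_y.
-- Replacing X_x by X_y is again a tree decomposition of breadth 1 with strictly more
-- (node, vertex) incidences, of which there are at most |T| · |V|; hence after finitely
-- many replacements every bag contains its centre, which is a star-decomposition.
module Submission where

open import Defs
open import Data.Nat using (ℕ; zero; suc; _≤_; _<_; _+_; _*_; z≤n; s≤s)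
open import Data.Nat.Properties
  using (+-mono-≤; +-mono-<-≤; +-mono-≤-<; +-monoˡ-<; +-identityʳ; +-suc; <⇒≱; ≤-<-trans)
import Data.Nat.Properties as ℕ
open import Algebra.Properties.Monoid.Sum ℕ.+-0-monoid using (sum-syntax)
open import Data.Fin using (Fin) renaming (zero to fzero; suc to fsuc)
open import Data.Fin.Properties using (_≟_; all?; any?; ¬∀⟶∃¬)
open import Data.Fin.Subset using (Subset; _∈_; _∉_; _⊆_; _⊂_; ∣_∣)
open import Data.Fin.Subset.Properties using (_∈?_; p⊆q⇒∣p∣≤∣q∣; p⊂q⇒∣p∣<∣q∣; ∣p∣≤n)
open import Data.Vec.Functional using (updateAt)
open import Data.Vec.Functional.Properties using (updateAt-updates; updateAt-minimal)
open import Data.List using (_∷_)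
open import Data.List.Membership.Propositional using () renaming (_∈_ to _∈ₗ_)
open import Data.List.Relation.Unary.Any using (here; there)
open import Data.List.Relation.Unary.All using (All; []; _∷_)
open import Data.List.Relation.Unary.All.Properties.Core using (¬Any⇒All¬)
open import Data.List.Relation.Unary.Unique.Propositional using (Unique)
open import Data.List.Relation.Unary.AllPairs using ([]; _∷_)
open import Data.Product using (∃; ∃₂; _×_; _,_; proj₁; proj₂)
open import Data.Sum using (_⊎_; inj₁; inj₂)
open import Data.Empty using (⊥-elim)
open import Function using (const; _∘_)
open import Function.Bundles using (_⇔_; mk⇔)
open import Relation.Nullary using (¬_; Dec; yes; no; ¬?; _×-dec_)
open import Relation.Nullary.Decidable using (decidable-stable)
open import Relation.Binary.Definitions using (DecidableEquality)
open import Relation.Binary.PropositionalEquality using (_≡_; _≢_; refl; subst; cong) renaming (sym to ≡-sym)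

∑-mono-≤ : ∀ {k} {f g : Fin k → ℕ} → (∀ i → f i ≤ g i) → ∑[ i < k ] f i ≤ ∑[ i < k ] g i
∑-mono-≤ {zero}  f≤g = z≤n
∑-mono-≤ {suc k} f≤g = +-mono-≤ (f≤g fzero) (∑-mono-≤ (f≤g ∘ fsuc))

∑-mono-< : ∀ {k} {f g : Fin k → ℕ} → (∀ i → f i ≤ g i) → ∀ j → f j < g j →
           ∑[ i < k ] f i < ∑[ i < k ] g i
∑-mono-< {suc k} f≤g fzero    fj<gj = +-mono-<-≤ fj<gj (∑-mono-≤ (f≤g ∘ fsuc))
∑-mono-< {suc k} f≤g (fsuc j) fj<gj = +-mono-≤-< (f≤g fzero) (∑-mono-< (f≤g ∘ fsuc) j fj<gj)

∑-≤-* : ∀ {k c} {f : Fin k → ℕ} → (∀ i → f i ≤ c) → ∑[ i < k ] f i ≤ k * c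
∑-≤-* {zero}  f≤c = z≤n
∑-≤-* {suc k} f≤c = +-mono-≤ (f≤c fzero) (∑-≤-* (f≤c ∘ fsuc))

⊆⊎∃∉ : ∀ {n} (p q : Subset n) → p ⊆ q ⊎ ∃ λ x → x ∈ p × x ∉ q
⊆⊎∃∉ p q with any? (λ x → x ∈? p ×-dec ¬? (x ∈? q))
... | yes witness = inj₂ witness
... | no ∄x       = inj₁ λ {x} x∈p → decidable-stable (x ∈? q) (λ x∉q → ∄x (x , x∈p , x∉q))

updateAt-cases : ∀ {A : Set} {k} (xs : Fin k → A) j (f : A → A) i →
                 (i ≡ j × updateAt xs j f i ≡ f (xs j)) ⊎ updateAt xs j f i ≡ xs i
updateAt-cases xs j f i with i ≟ j
... | yes refl = inj₁ (refl , updateAt-updates i xs)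
... | no i≢j   = inj₂ (updateAt-minimal i j xs i≢j)

module _ {V : Set} where

  _++ʷ_ : ∀ {E : V → V → Set} {u v w k j} → Walk E u v k → Walk E v w j → Walk E u w (k + j)
  []      ++ʷ q = q
  (e ∷ p) ++ʷ q = e ∷ (p ++ʷ q)

  mapʷ : ∀ {E F : V → V → Set} {u w k} → (∀ {x y} → E x y → F x y) → Walk E u w k → Walk F u w k
  mapʷ f []      = []
  mapʷ f (e ∷ p) = f e ∷ mapʷ f p

  walkVertices-mapʷ : ∀ {E F : V → V → Set} {u w k} (f : ∀ {x y} → E x y → F x y)
                      (p : Walk E u w k) → walkVertices (mapʷ f p) ≡ walkVertices p
  walkVertices-mapʷ f []      = refl
  walkVertices-mapʷ f (e ∷ p) = cong (_ ∷_) (walkVertices-mapʷ f p)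

  All-source : ∀ {E : V → V → Set} {P : V → Set} {u w k} (p : Walk E u w k) →
               All P (walkVertices p) → P u
  All-source []      (Pu ∷ _) = Pu
  All-source (_ ∷ _) (Pu ∷ _) = Pu

  avoiding : ∀ {E : V → V → Set} {a u w k} (p : Walk E u w k) → All (a ≢_) (walkVertices p) →
             Walk (λ x y → E x y × a ≢ y) u w k
  avoiding []      _         = []
  avoiding (e ∷ p) (_ ∷ a∉p) = (e , All-source p a∉p) ∷ avoiding p a∉p

  Path : (V → V → Set) → V → V → Set
  Path E u w = ∃₂ λ k (p : Walk E u w k) → Unique (walkVertices p)

  module _ (_≟ᵛ_ : DecidableEquality V) where
    open import Data.List.Membership.DecPropositional _≟ᵛ_ using () renaming (_∈?_ to _∈ₗ?_)

    suffixFrom : ∀ {E : V → V → Set} {x u w k} (p : Walk E u w k) → Unique (walkVertices p) →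
                 x ∈ₗ walkVertices p → Path E x w
    suffixFrom []      up       (here refl) = _ , [] , up
    suffixFrom (e ∷ p) up       (here refl) = _ , e ∷ p , up
    suffixFrom (e ∷ p) (_ ∷ up) (there x∈p) = suffixFrom p up x∈p

    walk⇒path : ∀ {E : V → V → Set} {u w k} → Walk E u w k → Path E u w
    walk⇒path []                 = _ , [] , ([] ∷ [])
    walk⇒path {u = u} (e ∷ p) with walk⇒path p
    ... | _ , q , uq with u ∈ₗ? walkVertices q
    ...   | yes u∈q = suffixFrom q uq u∈q
    ...   | no  u∉q = _ , e ∷ q , (¬Any⇒All¬ _ u∉q ∷ uq)

distLe1⇒≡⊎Adj : ∀ {n} {G : Graph n} {v w} → DistLe G v w 1 → v ≡ w ⊎ Adj G v w
distLe1⇒≡⊎Adj (_ , _      , [])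
  = inj₁ refl
distLe1⇒≡⊎Adj (_ , _      , e ∷ [])
  = inj₂ e
distLe1⇒≡⊎Adj (_ , s≤s () , _ ∷ _ ∷ _)

module _ {m} (T : Graph m) where

  AdjExcept : Fin m → Fin m → Fin m → Fin m → Set
  AdjExcept b a x y = Adj T x y × (b ≢ x ⊎ a ≢ y)

  acyclic⇒bridge : Acyclic T → ∀ {a b k} → Adj T a b → ¬ Walk (AdjExcept b a) b a k
  acyclic⇒bridge acyclic {a} {b} e p with walk⇒path _≟_ p
  ... | _ , q , uq = noDetour q uq
    where
      noDetour : ∀ {k} (q : Walk (AdjExcept b a) b a k) → ¬ Unique (walkVertices q)
      noDetour []                       _  = irrefl T e
      noDetour ((_ , inj₁ b≢b) ∷ [])    _  = b≢b refl
      noDetour ((_ , inj₂ a≢a) ∷ [])    _  = a≢a refl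
      noDetour q@(_ ∷ _ ∷ _)            uq =
        acyclic (mapʷ proj₁ q) (s≤s (s≤s z≤n)) (subst Unique (≡-sym (walkVertices-mapʷ proj₁ q)) uq) e

  InducesConnected-extend : ∀ {S S′ : Fin m → Set} → InducesConnected T S → (∀ {t} → S t → S′ t) →
                            (∀ {t} → S′ t → S t ⊎ ∃ λ s → S s × Adj T t s) → InducesConnected T S′
  InducesConnected-extend {S} {S′} connected S⊆S′ near t₁ t₂ h₁ h₂ =
    let s₁ , S₁ , _ , p₁ = enter h₁
        s₂ , S₂ , _ , p₂ = leave h₂
    in _ , p₁ ++ʷ (mapʷ inS′ (proj₂ (connected s₁ s₂ S₁ S₂)) ++ʷ p₂)
    where
      E′ : Fin m → Fin m → Set
      E′ a b = Adj T a b × S′ a × S′ b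

      inS′ : ∀ {a b} → Adj T a b × S a × S b → E′ a b
      inS′ (e , Sa , Sb) = e , S⊆S′ Sa , S⊆S′ Sb

      enter : ∀ {t} → S′ t → ∃ λ s → S s × ∃ λ k → Walk E′ t s k
      enter {t} h with near h
      ... | inj₁ St             = t , St , _ , []
      ... | inj₂ (s , Ss , e)   = s , Ss , _ , (e , h , S⊆S′ Ss) ∷ []

      leave : ∀ {t} → S′ t → ∃ λ s → S s × ∃ λ k → Walk E′ s t k
      leave {t} h with near h
      ... | inj₁ St             = t , St , _ , []
      ... | inj₂ (s , Ss , e)   = s , Ss , _ , (sym T e , S⊆S′ Ss , h) ∷ []

module _ {n} {G : Graph n} where

  star⇒breadth1 : (D : TreeDecomposition G) → IsStarDecomposition D → BreadthLe D 1
  star⇒breadth1 D star t = c , λ w w∈t → reach w w∈t (w ≟ c)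
    where
      c : Fin n
      c = proj₁ (star t)
      reach : ∀ w → w ∈ bag D t → Dec (w ≡ c) → DistLe G c w 1
      reach w w∈t (yes refl) = 0 , z≤n , []
      reach w w∈t (no w≢c)   = 1 , s≤s z≤n , proj₂ (proj₂ (star t)) w w∈t w≢c ∷ []

  ShareBag : TreeDecomposition G → Fin n → Fin n → Set
  ShareBag D v w = ∃ λ s → v ∈ bag D s × w ∈ bag D s

  module _ (D : TreeDecomposition G) where

    bag-step-towards : ∀ {a b s v w k} → Adj (T D) a b →
                       (r : Walk (Adj (T D)) b s k) → All (a ≢_) (walkVertices r) →
                       v ∈ bag D s → v ∉ bag D a → w ∈ bag D a → ShareBag D v w → w ∈ bag D b
    bag-step-towards {a} {b} {s} {v} {w} e r a∉r v∈s v∉a w∈a (s′ , v∈s′ , w∈s′) with w ∈? bag D b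
    ... | yes w∈b = w∈b
    ... | no  w∉b = ⊥-elim (acyclic⇒bridge (T D) (proj₂ (isTree D)) e detour)
      where
        -- b ⇝ s avoiding a, then s ⇝ s′ inside the subtree of v ∌ a, then s′ ⇝ a inside the subtree of w ∌ b.
        detour : Walk (AdjExcept (T D) b a) b a _
        detour = mapʷ (λ (e , a≢y) → e , inj₂ a≢y) (avoiding r a∉r)
            ++ʷ (mapʷ (λ (e , _ , v∈y) → e , inj₂ λ { refl → v∉a v∈y })
                      (proj₂ (subtree D v s s′ v∈s v∈s′))
            ++ʷ  mapʷ (λ (e , w∈x , _) → e , inj₁ λ { refl → w∉b w∈x })
                      (proj₂ (subtree D w s′ a w∈s′ w∈a)))

    ⊂-edge : ∀ {a s v k} (p : Walk (Adj (T D)) a s k) → Unique (walkVertices p) →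
             v ∈ bag D s → v ∉ bag D a → (∀ {w} → w ∈ bag D a → ShareBag D v w) →
             ∃₂ λ x y → Adj (T D) x y × bag D x ⊂ bag D y
    ⊂-edge []                    _          v∈s v∉a _     = ⊥-elim (v∉a v∈s)
    ⊂-edge {a} (_∷_ {v = b} e r) (a∉r ∷ ur) v∈s v∉a share with ⊆⊎∃∉ (bag D b) (bag D a)
    ... | inj₁ b⊆a = ⊂-edge r ur v∈s (v∉a ∘ b⊆a) (share ∘ b⊆a)
    ... | inj₂ (x , x∈b , x∉a) =
      a , b , e , (λ w∈a → bag-step-towards e r a∉r v∈s v∉a w∈a (share w∈a)) , x , x∈b , x∉a

    uncentred⇒⊂-edge : ∀ {t c} → c ∉ bag D t → (∀ w → w ∈ bag D t → DistLe G c w 1) →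
                       ∃₂ λ x y → Adj (T D) x y × bag D x ⊂ bag D y
    uncentred⇒⊂-edge {t} {c} c∉t near =
      let s , c∈s  = covers D c
          _ , p , up = walk⇒path _≟_ (proj₂ (proj₁ (isTree D) t s))
      in ⊂-edge p up c∈s c∉t share
      where
        share : ∀ {w} → w ∈ bag D t → ShareBag D c w
        share {w} w∈t with distLe1⇒≡⊎Adj {G = G} (near w w∈t)
        ... | inj₁ refl = ⊥-elim (c∉t w∈t)
        ... | inj₂ c~w  = edgeIn D c w c~w

  module Replace (D : TreeDecomposition G) {x y : Fin (m D)}
                 (x~y : Adj (T D) x y) (x⊆y : bag D x ⊆ bag D y) where

    bag′ : Fin (m D) → Subset n
    bag′ = updateAt (bag D) x (const (bag D y))

    bag⊆bag′ : ∀ t → bag D t ⊆ bag′ t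
    bag⊆bag′ t with updateAt-cases (bag D) x (const (bag D y)) t
    ... | inj₁ (refl , eq) = subst (bag D t ⊆_) (≡-sym eq) x⊆y
    ... | inj₂ eq          = subst (bag D t ⊆_) (≡-sym eq) (λ v∈t → v∈t)

    bag′-isBag : ∀ t → ∃ λ t′ → bag′ t ≡ bag D t′
    bag′-isBag t with updateAt-cases (bag D) x (const (bag D y)) t
    ... | inj₁ (_ , eq) = y , eq
    ... | inj₂ eq       = t , eq

    bag′-near : ∀ v {t} → v ∈ bag′ t → v ∈ bag D t ⊎ ∃ λ s → v ∈ bag D s × Adj (T D) t s
    bag′-near v {t} v∈t with updateAt-cases (bag D) x (const (bag D y)) t
    ... | inj₁ (refl , eq) = inj₂ (y , subst (v ∈_) eq v∈t , x~y)
    ... | inj₂ eq          = inj₁ (subst (v ∈_) eq v∈t)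

    replaced : TreeDecomposition G
    replaced = record
      { m       = m D
      ; T       = T D
      ; isTree  = isTree D
      ; bag     = bag′
      ; covers  = λ v → let t , v∈t = covers D v in t , bag⊆bag′ t v∈t
      ; edgeIn  = λ u v u~v → let t , u∈t , v∈t = edgeIn D u v u~v
                              in t , bag⊆bag′ t u∈t , bag⊆bag′ t v∈t
      ; subtree = λ v → InducesConnected-extend (T D) (subtree D v) (bag⊆bag′ _) (bag′-near v)
      }

    replaced-breadth : ∀ {r} → BreadthLe D r → BreadthLe replaced r
    replaced-breadth breadth t =
      let t′ , eq = bag′-isBag t
          c , near = breadth t′
      in c , λ w w∈t → near w (subst (w ∈_) eq w∈t)

  weight : TreeDecomposition G → ℕ
  weight D = ∑[ t < m D ] ∣ bag D t ∣

  weight≤ : ∀ D → weight D ≤ m D * n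
  weight≤ D = ∑-≤-* (λ t → ∣p∣≤n (bag D t))

  weight-replaced : ∀ D {x y} (x~y : Adj (T D) x y) (x⊂y : bag D x ⊂ bag D y) →
                    weight D < weight (Replace.replaced D x~y (proj₁ x⊂y))
  weight-replaced D {x} x~y (x⊆y , v , v∈y , v∉x) =
    ∑-mono-< (λ t → p⊆q⇒∣p∣≤∣q∣ (bag⊆bag′ t)) x
             (p⊂q⇒∣p∣<∣q∣ (bag⊆bag′ x , v , subst (v ∈_) (≡-sym (updateAt-updates x (bag D))) v∈y , v∉x))
    where open Replace D x~y x⊆y

  star⊎⊂-edge : ∀ D → BreadthLe D 1 →
                IsStarDecomposition D ⊎ ∃₂ λ x y → Adj (T D) x y × bag D x ⊂ bag D y
  star⊎⊂-edge D breadth with all? (λ t → proj₁ (breadth t) ∈? bag D t)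
  ... | yes centred = inj₁ λ t → proj₁ (breadth t) , centred t , adjacent t
    where
      adjacent : ∀ t w → w ∈ bag D t → w ≢ proj₁ (breadth t) → Adj G (proj₁ (breadth t)) w
      adjacent t w w∈t w≢c with distLe1⇒≡⊎Adj {G = G} (proj₂ (breadth t) w w∈t)
      ... | inj₁ refl = ⊥-elim (w≢c refl)
      ... | inj₂ c~w  = c~w
  ... | no ¬centred =
    let t , c∉t = ¬∀⟶∃¬ (m D) _ (λ t → proj₁ (breadth t) ∈? bag D t) ¬centred
    in inj₂ (uncentred⇒⊂-edge D c∉t (proj₂ (breadth t)))

  breadth1⇒star : ∀ fuel D → BreadthLe D 1 → m D * n < weight D + fuel → HasStarDecomposition G
  breadth1⇒star zero D _ bound =
    ⊥-elim (<⇒≱ bound (subst (_≤ m D * n) (≡-sym (+-identityʳ (weight D))) (weight≤ D)))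
  breadth1⇒star (suc fuel) D breadth bound with star⊎⊂-edge D breadth
  ... | inj₁ star = D , star
  ... | inj₂ (x , y , x~y , x⊂y) =
    breadth1⇒star fuel replaced (replaced-breadth breadth)
      (≤-<-trans bound′ (+-monoˡ-< fuel (weight-replaced D x~y x⊂y)))
    where
      open Replace D x~y (proj₁ x⊂y)
      bound′ : m D * n ≤ weight D + fuel
      bound′ with subst (m D * n <_) (+-suc (weight D) fuel) bound
      ... | s≤s le = le

corollary1 : ∀ {n : ℕ} (G : Graph n) → 1 ≤ n → Connected G →
    TreeBreadthLe G 1 ⇔ HasStarDecomposition G
corollary1 G _ _ = mk⇔
  (λ (D , breadth) → breadth1⇒star (suc (m D * _)) D breadth (ℕ.m≤n+m _ _))
  (λ (D , star) → D , star⇒breadth1 D star)
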